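{- Let $q,d,z\in\mathbb{N}$ and define $f(1,q,d):=zq+d$ and, for integers $k>1$, \[f(k,q,d):=(zq+d)\,k\Big(1+\sum_{i=1}^{k-1}\frac{1}{i}\Big).\] Let $A_1,\dots,A_k$ be pairwise disjoint finite sets. If $\sum_{i\in I}|A_i|>f(|I|,q,d)$ holds for all non-empty subsets $I\subseteq\{1,\dots,k\}$, then Maker wins the game $B(A_1,\dots,A_k;q,z)$ by playing $d$-greedily.
   Context: The box game $B(A_1,\dots,A_k;q,z)$ is played on pairwise disjoint finite sets $A_1,\dots,A_k$ by Maker and Breaker, taking turns with Maker moving first. In a Maker move, an unclaimed element of some still-present set is claimed (as a Maker element) and that set is removed from the game. In a Breaker move, Breaker claims at most $q$ unclaimed elements from the still-present sets. Moreover, Breaker is allowed to steal all of Maker's moves except every $z$-th one (i.e. Maker himself makes his 1st, $(z+1)$-th, $(2z+1)$-th, … moves, while each of the others may be made by Breaker): in a stolen move Breaker chooses an element from an arbitrary still-present set, it is labelled a Maker element and that set is removed. Maker wins if every set eventually has an element claimed in a Maker move (real or stolen); Breaker wins if he claims all elements of some set before that. Maker plays $d$-greedily if in each of his own (non-stolen) moves he claims an element from a set whose current number of unclaimed elements is at most $d$ larger than that of the currently smallest still-present set. -}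

module Defs where

open import Data.Nat as ℕ using (ℕ; zero; suc; _+_; _*_; _∸_; _≤_)
open import Data.Nat.Divisibility using (_∣_)
open import Data.Integer using (+_)
open import Data.Rational as ℚ using (ℚ; _/_)
open import Data.Bool using (Bool; true; false; if_then_else_)
open import Data.Fin using (Fin; zero; suc; _≟_)
open import Relation.Nullary using (yes; no)
open import Data.Fin.Subset using (Subset)
open import Data.Vec using (lookup)
open import Relation.Binary.PropositionalEquality using (_≡_)

ℕtoℚ : ℕ → ℚ
ℕtoℚ n = (+ n) / 1

H : ℕ → ℚ
H zero    = ℚ.0ℚ
H (suc n) = H n ℚ.+ ((+ 1) / suc n)

f : (z q d m : ℕ) → ℚ
f z q d m = ℕtoℚ ((z * q + d) * m) ℚ.* (ℚ.1ℚ ℚ.+ H (m ∸ 1))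

Σ : (n : ℕ) → (Fin n → ℕ) → ℕ
Σ zero    g = 0
Σ (suc n) g = g zero + Σ n (λ i → g (suc i))

sumOver : {k : ℕ} → Subset k → (Fin k → ℕ) → ℕ
sumOver {k} I a = Σ k (λ i → if lookup I i then a i else 0)

-- Game state of B(A_1,…,A_k;q,z), boxes represented by their numbers of
-- unclaimed elements (elements inside a box are interchangeable).
record State (k : ℕ) : Set where
  constructor st
  field
    moves   : ℕ              -- number of Maker moves (real or stolen) made so far
    present : Fin k → Bool
    free    : Fin k → ℕ
open State public

remove : {k : ℕ} → (Fin k → Bool) → Fin k → (Fin k → Bool)
remove p i j with i ≟ j
... | yes _ = false
... | no  _ = p j

-- The (m+1)-th Maker
-- move (m = moves s) is Maker's own move when z ∣ m (1st, (z+1)-th, ...);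
-- otherwise it may be stolen by Breaker (arbitrary present box) or made by
-- Maker himself (d-greedy).
DGreedy : {k : ℕ} (d : ℕ) → State k → Fin k → Set
DGreedy d s i = ∀ j → present s j ≡ true → free s i ≤ free s j + d

-- Positions reachable in a play where all of Maker's own moves are d-greedy.
mutual
  data MakerTurn (q d z : ℕ) {k : ℕ} (a : Fin k → ℕ) : State k → Set where
    start : MakerTurn q d z a (st 0 (λ _ → true) a)
    breakerMove : ∀ {s} → BreakerTurn q d z a s →
      (c : Fin k → ℕ) →
      (∀ i → c i ≤ free s i) →
      (∀ i → present s i ≡ false → c i ≡ 0) →
      Σ k c ≤ q →
      MakerTurn q d z a (st (moves s) (present s) (λ i → free s i ∸ c i))

  data BreakerTurn (q d z : ℕ) {k : ℕ} (a : Fin k → ℕ) : State k → Set where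
    makerMove : ∀ {s} → MakerTurn q d z a s →
      (i : Fin k) →
      present s i ≡ true →
      1 ≤ free s i →
      (z ∣ moves s → DGreedy d s i) →
      BreakerTurn q d z a (st (suc (moves s)) (remove (present s) i) (free s))

-- Maker wins B(A_1,…,A_k;q,z) playing d-greedily: in every such play, Breaker
-- never claims all elements of a still-present box, i.e. at each Maker turn
-- every present box has an unclaimed element.  (Each Maker move removes a box,
-- so the game then ends with every box containing a Maker element.)
MakerWinsGreedy : (q d z : ℕ) {k : ℕ} (a : Fin k → ℕ) → Set
MakerWinsGreedy q d z {k} a =
  ∀ s → MakerTurn q d z a s → ∀ i → present s i ≡ true → 1 ≤ free s i

module Submission where

open import Defs
open import Data.Nat using (ℕ; _≤_)
open import Data.Fin using (Fin)
open import Data.Fin.Subset using (Subset; Nonempty; ∣_∣)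
open import Data.Rational using (_<_)

open import Data.Nat as ℕ using (zero; suc; _+_; _*_; _∸_; z≤n; s≤s)
import Data.Nat.Properties as ℕ
open import Data.Nat.Coprimality using (1-coprimeTo)
import Data.Nat.Coprimality as Coprime
open import Data.Nat.Divisibility using (divides; _∣?_)
open import Data.Nat.Solver using (module +-*-Solver)
import Data.Integer as ℤ
import Data.Integer.Properties as ℤ
open import Data.Rational as ℚ using (ℚ; mkℚ; _/_; 1ℚ)
import Data.Rational.Properties as ℚ
import Data.Rational.Solver as ℚ-Solver
open import Data.Bool using (Bool; true; false; if_then_else_; _∨_)
open import Data.Fin using (zero; suc; _≟_)
open import Data.Vec using (tabulate)
import Data.Vec.Properties as Vec
open import Data.Product using (∃; _×_; _,_)
open import Data.Empty using (⊥-elim)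
open import Relation.Nullary using (yes; no)
open import Relation.Binary.PropositionalEquality
open import Algebra.Properties.CommutativeSemigroup ℕ.+-commutativeSemigroup
  using () renaming (interchange to +-interchange)

-- Maker's strategy is analysed through a potential invariant.  Call a
-- position u-safe if every nonempty group P of still-present boxes satisfies
--     f(|P|) < Σ_{i∈P} free(i) + u·q,
-- where u ≤ z is the number of Breaker moves since Maker's last own move.
-- The hypothesis says the start is 0-safe; a Breaker move raises u by one;
-- a stolen Maker move only removes a box, so it keeps u-safety; and a
-- d-greedy own Maker move restores 0-safety, by the recurrence
--     m·f(m+1) = (m+1)·(f(m) + zq + d)
-- of the threshold f ("F-descent").  Applied to a single present box, u-safety
-- with u ≤ z gives zq + d < free(i) + u·q ≤ free(i) + zq + d, so no present box
-- is ever exhausted.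

-- ℕtoℚ n is already in lowest terms, so it is the literal fraction n/1.
ℕtoℚ-normal : ∀ n → ℕtoℚ n ≡ mkℚ (ℤ.+ n) 0 (Coprime.sym (1-coprimeTo n))
ℕtoℚ-normal n = ℚ.normalize-coprime (Coprime.sym (1-coprimeTo n))

ℕtoℚ-+ : ∀ m n → ℕtoℚ (m + n) ≡ ℕtoℚ m ℚ.+ ℕtoℚ n
ℕtoℚ-+ m n rewrite ℕtoℚ-normal m | ℕtoℚ-normal n =
  ℚ./-cong (cong₂ ℤ._+_ (sym (ℤ.*-identityʳ (ℤ.+ m))) (sym (ℤ.*-identityʳ (ℤ.+ n)))) refl

ℕtoℚ-* : ∀ m n → ℕtoℚ (m * n) ≡ ℕtoℚ m ℚ.* ℕtoℚ n
ℕtoℚ-* m n rewrite ℕtoℚ-normal m | ℕtoℚ-normal n = ℚ./-cong (ℤ.pos-* m n) refl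

ℕtoℚ-mono-≤ : ∀ {m n} → m ≤ n → ℕtoℚ m ℚ.≤ ℕtoℚ n
ℕtoℚ-mono-≤ {m} {n} m≤n rewrite ℕtoℚ-normal m | ℕtoℚ-normal n =
  ℚ.*≤* (subst₂ ℤ._≤_ (sym (ℤ.*-identityʳ (ℤ.+ m))) (sym (ℤ.*-identityʳ (ℤ.+ n))) (ℤ.+≤+ m≤n))

ℕtoℚ-cancel-< : ∀ {m n} → ℕtoℚ m < ℕtoℚ n → m ℕ.< n
ℕtoℚ-cancel-< {m} {n} lt rewrite ℕtoℚ-normal m | ℕtoℚ-normal n with lt
... | ℚ.*<* m<n rewrite ℤ.*-identityʳ (ℤ.+ m) | ℤ.*-identityʳ (ℤ.+ n) = ℤ.drop‿+<+ m<n

ℕtoℚ-inverse : ∀ n → ℕtoℚ (suc n) ℚ.* ((ℤ.+ 1) / suc n) ≡ 1ℚ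
ℕtoℚ-inverse n rewrite ℕtoℚ-normal (suc n) | ℚ.normalize-coprime (1-coprimeTo (suc n)) =
  ℚ.*-inverseʳ (mkℚ (ℤ.+ suc n) 0 (Coprime.sym (1-coprimeTo (suc n))))

ℕtoℚ-nonNeg : ∀ n → ℚ.NonNegative (ℕtoℚ n)
ℕtoℚ-nonNeg n = ℚ.normalize-nonNeg n 1

ℕtoℚ-pos : ∀ n → ℚ.Positive (ℕtoℚ (suc n))
ℕtoℚ-pos n = ℚ.normalize-pos (suc n) 1

cancelʳ-+-< : ∀ x y r → x ℚ.+ r < y ℚ.+ r → x < y
cancelʳ-+-< x y r lt = subst₂ _<_ (add-sub x) (add-sub y) (ℚ.+-monoˡ-< (ℚ.- r) lt)
  where
  add-sub : ∀ t → t ℚ.+ r ℚ.- r ≡ t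
  add-sub t = begin
    t ℚ.+ r ℚ.- r       ≡⟨ ℚ.+-assoc t r (ℚ.- r) ⟩
    t ℚ.+ (r ℚ.- r)     ≡⟨ cong (t ℚ.+_) (ℚ.+-inverseʳ r) ⟩
    t ℚ.+ ℚ.0ℚ          ≡⟨ ℚ.+-identityʳ t ⟩
    t                   ∎
    where open ≡-Reasoning

-- f z q d depends on z and q only through the rate c = z·q + d:
-- F c m = c·m·(1 + H(m−1)), and f z q d ≡ F (z * q + d) definitionally.
F : ℕ → ℕ → ℚ
F c m = ℕtoℚ (c * m) ℚ.* (1ℚ ℚ.+ H (m ∸ 1))

F-one : ∀ c → F c 1 ≡ ℕtoℚ c
F-one c = begin
  ℕtoℚ (c * 1) ℚ.* (1ℚ ℚ.+ ℚ.0ℚ)  ≡⟨ cong (ℕtoℚ (c * 1) ℚ.*_) (ℚ.+-identityʳ 1ℚ) ⟩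
  ℕtoℚ (c * 1) ℚ.* 1ℚ            ≡⟨ ℚ.*-identityʳ (ℕtoℚ (c * 1)) ⟩
  ℕtoℚ (c * 1)                   ≡⟨ cong ℕtoℚ (ℕ.*-identityʳ c) ⟩
  ℕtoℚ c                         ∎
  where open ≡-Reasoning

recurrence-identity : ∀ N C h r → N ℚ.* r ≡ 1ℚ →
  N ℚ.* ((C ℚ.* (1ℚ ℚ.+ N)) ℚ.* (1ℚ ℚ.+ (h ℚ.+ r)))
    ≡ (1ℚ ℚ.+ N) ℚ.* ((C ℚ.* N) ℚ.* (1ℚ ℚ.+ h) ℚ.+ C)
recurrence-identity N C h r Nr≡1 = begin
  N ℚ.* ((C ℚ.* (1ℚ ℚ.+ N)) ℚ.* (1ℚ ℚ.+ (h ℚ.+ r)))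
    ≡⟨ expand N C h r ⟩
  (C ℚ.* (1ℚ ℚ.+ N)) ℚ.* (N ℚ.* (1ℚ ℚ.+ h)) ℚ.+ (C ℚ.* (1ℚ ℚ.+ N)) ℚ.* (N ℚ.* r)
    ≡⟨ cong (λ t → (C ℚ.* (1ℚ ℚ.+ N)) ℚ.* (N ℚ.* (1ℚ ℚ.+ h)) ℚ.+ (C ℚ.* (1ℚ ℚ.+ N)) ℚ.* t) Nr≡1 ⟩
  (C ℚ.* (1ℚ ℚ.+ N)) ℚ.* (N ℚ.* (1ℚ ℚ.+ h)) ℚ.+ (C ℚ.* (1ℚ ℚ.+ N)) ℚ.* 1ℚ
    ≡⟨ collect N C h ⟩
  (1ℚ ℚ.+ N) ℚ.* ((C ℚ.* N) ℚ.* (1ℚ ℚ.+ h) ℚ.+ C)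
    ∎
  where
  open ≡-Reasoning
  open ℚ-Solver.+-*-Solver
  expand = solve 4 (λ N C h r →
    N :* ((C :* (con 1ℚ :+ N)) :* (con 1ℚ :+ (h :+ r)))
      := (C :* (con 1ℚ :+ N)) :* (N :* (con 1ℚ :+ h)) :+ (C :* (con 1ℚ :+ N)) :* (N :* r)) refl
  collect = solve 3 (λ N C h →
    (C :* (con 1ℚ :+ N)) :* (N :* (con 1ℚ :+ h)) :+ (C :* (con 1ℚ :+ N)) :* con 1ℚ
      := (con 1ℚ :+ N) :* ((C :* N) :* (con 1ℚ :+ h) :+ C)) refl

F-recurrence : ∀ c n →
  ℕtoℚ (suc n) ℚ.* F c (suc (suc n)) ≡ ℕtoℚ (suc (suc n)) ℚ.* (F c (suc n) ℚ.+ ℕtoℚ c)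
F-recurrence c n = begin
  N ℚ.* (ℕtoℚ (c * suc (suc n)) ℚ.* (1ℚ ℚ.+ (H n ℚ.+ r)))
    ≡⟨ cong (λ t → N ℚ.* (t ℚ.* (1ℚ ℚ.+ (H n ℚ.+ r)))) c[2+n] ⟩
  N ℚ.* ((C ℚ.* (1ℚ ℚ.+ N)) ℚ.* (1ℚ ℚ.+ (H n ℚ.+ r)))
    ≡⟨ recurrence-identity N C (H n) r (ℕtoℚ-inverse n) ⟩
  (1ℚ ℚ.+ N) ℚ.* ((C ℚ.* N) ℚ.* (1ℚ ℚ.+ H n) ℚ.+ C)
    ≡⟨ cong₂ (λ a b → a ℚ.* (b ℚ.* (1ℚ ℚ.+ H n) ℚ.+ C)) (sym (ℕtoℚ-+ 1 (suc n))) (sym (ℕtoℚ-* c (suc n))) ⟩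
  ℕtoℚ (suc (suc n)) ℚ.* (F c (suc n) ℚ.+ C)
    ∎
  where
  open ≡-Reasoning
  C = ℕtoℚ c
  N = ℕtoℚ (suc n)
  r = (ℤ.+ 1) / suc n
  c[2+n] : ℕtoℚ (c * suc (suc n)) ≡ C ℚ.* (1ℚ ℚ.+ N)
  c[2+n] = trans (ℕtoℚ-* c (suc (suc n))) (cong (C ℚ.*_) (ℕtoℚ-+ 1 (suc n)))

F-descent : ∀ c m X W → 1 ≤ m → F c (suc m) < ℕtoℚ W →
            m * W ≤ suc m * X + m * c → F c m < ℕtoℚ X
F-descent c (suc n) X W _ F<W mW≤ =
  cancelʳ-+-< _ _ C (ℚ.*-cancelˡ-<-nonNeg M' {{ℕtoℚ-nonNeg (suc (suc n))}} chain)
  where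
  open ℚ.≤-Reasoning
  C = ℕtoℚ c
  M = ℕtoℚ (suc n)
  M' = ℕtoℚ (suc (suc n))
  chain : M' ℚ.* (F c (suc n) ℚ.+ C) < M' ℚ.* (ℕtoℚ X ℚ.+ C)
  chain = begin-strict
    M' ℚ.* (F c (suc n) ℚ.+ C)       ≡⟨ F-recurrence c n ⟨
    M ℚ.* F c (suc (suc n))          <⟨ ℚ.*-monoʳ-<-pos M {{ℕtoℚ-pos n}} F<W ⟩
    M ℚ.* ℕtoℚ W                     ≡⟨ ℕtoℚ-* (suc n) W ⟨
    ℕtoℚ (suc n * W)                 ≤⟨ ℕtoℚ-mono-≤ (ℕ.≤-trans mW≤ (ℕ.+-monoʳ-≤ (suc (suc n) * X) (ℕ.*-monoˡ-≤ c (ℕ.n≤1+n (suc n))))) ⟩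
    ℕtoℚ (suc (suc n) * X + suc (suc n) * c)
      ≡⟨ cong ℕtoℚ (ℕ.*-distribˡ-+ (suc (suc n)) X c) ⟨
    ℕtoℚ (suc (suc n) * (X + c))     ≡⟨ trans (ℕtoℚ-* (suc (suc n)) (X + c)) (cong (M' ℚ.*_) (ℕtoℚ-+ X c)) ⟩
    M' ℚ.* (ℕtoℚ X ℚ.+ C)            ∎

Σ-cong : ∀ k {g h : Fin k → ℕ} → (∀ i → g i ≡ h i) → Σ k g ≡ Σ k h
Σ-cong zero    g≡h = refl
Σ-cong (suc k) g≡h = cong₂ _+_ (g≡h zero) (Σ-cong k (λ i → g≡h (suc i)))

Σ-mono-≤ : ∀ k {g h : Fin k → ℕ} → (∀ i → g i ≤ h i) → Σ k g ≤ Σ k h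
Σ-mono-≤ zero    g≤h = z≤n
Σ-mono-≤ (suc k) g≤h = ℕ.+-mono-≤ (g≤h zero) (Σ-mono-≤ k (λ i → g≤h (suc i)))

Σ-+ : ∀ k (g h : Fin k → ℕ) → Σ k (λ i → g i + h i) ≡ Σ k g + Σ k h
Σ-+ zero    g h = refl
Σ-+ (suc k) g h = begin
  (g zero + h zero) + Σ k (λ i → g (suc i) + h (suc i))
    ≡⟨ cong ((g zero + h zero) +_) (Σ-+ k (λ i → g (suc i)) (λ i → h (suc i))) ⟩
  (g zero + h zero) + (Σ k (λ i → g (suc i)) + Σ k (λ i → h (suc i)))
    ≡⟨ +-interchange (g zero) (h zero) _ _ ⟩
  (g zero + Σ k (λ i → g (suc i))) + (h zero + Σ k (λ i → h (suc i)))
    ∎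
  where open ≡-Reasoning

Σ-*ʳ : ∀ k (g : Fin k → ℕ) y → Σ k g * y ≡ Σ k (λ i → g i * y)
Σ-*ʳ zero    g y = refl
Σ-*ʳ (suc k) g y = trans (ℕ.*-distribʳ-+ y (g zero) (Σ k (λ i → g (suc i))))
                         (cong (g zero * y +_) (Σ-*ʳ k (λ i → g (suc i)) y))

Σ-zero : ∀ k → Σ k (λ _ → 0) ≡ 0
Σ-zero zero    = refl
Σ-zero (suc k) = Σ-zero k

sumWhere : ∀ {k} → (Fin k → Bool) → (Fin k → ℕ) → ℕ
sumWhere {k} P g = Σ k (λ i → if P i then g i else 0)

count : ∀ {k} → (Fin k → Bool) → ℕ
count P = sumWhere P (λ _ → 1)

sumWhere-mono-≤ : ∀ {k} (P : Fin k → Bool) {g h : Fin k → ℕ} →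
                  (∀ i → P i ≡ true → g i ≤ h i) → sumWhere P g ≤ sumWhere P h
sumWhere-mono-≤ {k} P {g} {h} g≤h = Σ-mono-≤ k pointwise
  where
  pointwise : ∀ i → (if P i then g i else 0) ≤ (if P i then h i else 0)
  pointwise i with P i in Pi
  ... | true  = g≤h i Pi
  ... | false = z≤n

sumWhere-+ : ∀ {k} (P : Fin k → Bool) (g h : Fin k → ℕ) →
             sumWhere P (λ i → g i + h i) ≡ sumWhere P g + sumWhere P h
sumWhere-+ {k} P g h = trans (Σ-cong k pointwise) (Σ-+ k _ _)
  where
  pointwise : ∀ i → (if P i then g i + h i else 0)
                    ≡ (if P i then g i else 0) + (if P i then h i else 0)
  pointwise i with P i
  ... | true  = refl
  ... | false = refl

count-* : ∀ {k} (P : Fin k → Bool) y → count P * y ≡ sumWhere P (λ _ → y)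
count-* {k} P y = trans (Σ-*ʳ k _ y) (Σ-cong k pointwise)
  where
  pointwise : ∀ i → (if P i then 1 else 0) * y ≡ (if P i then y else 0)
  pointwise i with P i
  ... | true  = ℕ.+-identityʳ y
  ... | false = refl

sumWhere-∸ : ∀ {k} (P : Fin k → Bool) (g c : Fin k → ℕ) → (∀ i → c i ≤ g i) →
             sumWhere P g ≤ sumWhere P (λ i → g i ∸ c i) + Σ k c
sumWhere-∸ {k} P g c c≤g = begin
  sumWhere P g                                         ≤⟨ Σ-mono-≤ k pointwise ⟩
  Σ k (λ i → (if P i then g i ∸ c i else 0) + c i)     ≡⟨ Σ-+ k _ c ⟩
  sumWhere P (λ i → g i ∸ c i) + Σ k c                 ∎
  where
  open ℕ.≤-Reasoning
  pointwise : ∀ i → (if P i then g i else 0) ≤ (if P i then g i ∸ c i else 0) + c i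
  pointwise i with P i
  ... | true  = ℕ.≤-reflexive (sym (ℕ.m∸n+n≡m (c≤g i)))
  ... | false = z≤n

count-*-≤ : ∀ {k} (P : Fin k → Bool) (g : Fin k → ℕ) y d →
            (∀ j → P j ≡ true → y ≤ g j + d) → count P * y ≤ sumWhere P g + count P * d
count-*-≤ P g y d y≤g+d = begin
  count P * y                              ≡⟨ count-* P y ⟩
  sumWhere P (λ _ → y)                     ≤⟨ sumWhere-mono-≤ P y≤g+d ⟩
  sumWhere P (λ j → g j + d)               ≡⟨ sumWhere-+ P g (λ _ → d) ⟩
  sumWhere P g + sumWhere P (λ _ → d)      ≡⟨ cong (sumWhere P g +_) (count-* P d) ⟨
  sumWhere P g + count P * d               ∎
  where open ℕ.≤-Reasoning

witness : ∀ {k} (P : Fin k → Bool) → 1 ≤ count P → ∃ λ i → P i ≡ true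
witness {suc k} P 1≤count with P zero in P0
... | true  = zero , P0
... | false with witness (λ i → P (suc i)) 1≤count
...   | i , Pi = suc i , Pi

only : ∀ {k} → Fin k → Fin k → Bool
only zero    zero    = true
only zero    (suc _) = false
only (suc _) zero    = false
only (suc x) (suc j) = only x j

only-sound : ∀ {k} (x j : Fin k) → only x j ≡ true → x ≡ j
only-sound zero    zero    _ = refl
only-sound (suc x) (suc j) e = cong suc (only-sound x j e)

sumWhere-only : ∀ {k} (x : Fin k) (g : Fin k → ℕ) → sumWhere (only x) g ≡ g x
sumWhere-only {suc k} zero    g = trans (cong (g zero +_) (Σ-zero k)) (ℕ.+-identityʳ (g zero))
sumWhere-only {suc k} (suc x) g = sumWhere-only x (λ i → g (suc i))

insert : ∀ {k} → Fin k → (Fin k → Bool) → Fin k → Bool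
insert x P j = only x j ∨ P j

sumWhere-insert : ∀ {k} (x : Fin k) (P : Fin k → Bool) (g : Fin k → ℕ) → P x ≡ false →
                  sumWhere (insert x P) g ≡ g x + sumWhere P g
sumWhere-insert {k} x P g Px = begin
  sumWhere (insert x P) g                 ≡⟨ Σ-cong k pointwise ⟩
  Σ k (λ j → (if only x j then g j else 0) + (if P j then g j else 0))
                                          ≡⟨ Σ-+ k _ _ ⟩
  sumWhere (only x) g + sumWhere P g      ≡⟨ cong (_+ sumWhere P g) (sumWhere-only x g) ⟩
  g x + sumWhere P g                      ∎
  where
  open ≡-Reasoning
  pointwise : ∀ j → (if only x j ∨ P j then g j else 0)
                    ≡ (if only x j then g j else 0) + (if P j then g j else 0)
  pointwise j with only x j in xj
  ... | false = refl
  ... | true rewrite sym (only-sound x j xj) | Px = sym (ℕ.+-identityʳ (g x))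

sumOver-tabulate : ∀ {k} (P : Fin k → Bool) (a : Fin k → ℕ) → sumOver (tabulate P) a ≡ sumWhere P a
sumOver-tabulate {k} P a = Σ-cong k (λ i → cong (λ b → if b then a i else 0) (Vec.lookup∘tabulate P i))

∣tabulate∣ : ∀ {k} (P : Fin k → Bool) → ∣ tabulate P ∣ ≡ count P
∣tabulate∣ {zero}  P = refl
∣tabulate∣ {suc k} P with P zero
... | true  = cong suc (∣tabulate∣ (λ i → P (suc i)))
... | false = ∣tabulate∣ (λ i → P (suc i))

nonempty-tabulate : ∀ {k} (P : Fin k → Bool) → 1 ≤ count P → Nonempty (tabulate P)
nonempty-tabulate P 1≤count with witness P 1≤count
... | i , Pi = i , Vec.lookup⇒[]= i (tabulate P) (trans (Vec.lookup∘tabulate P i) Pi)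

greedy-bound : ∀ m y X u q z d → u ≤ z → m * y ≤ X + m * d →
               m * ((y + X) + u * q) ≤ suc m * X + m * (z * q + d)
greedy-bound m y X u q z d u≤z my≤ = begin
  m * ((y + X) + u * q)                  ≡⟨ expand m y X (u * q) ⟩
  m * y + (m * X + m * (u * q))          ≤⟨ ℕ.+-mono-≤ my≤ (ℕ.+-monoʳ-≤ (m * X) (ℕ.*-monoʳ-≤ m (ℕ.*-monoˡ-≤ q u≤z))) ⟩
  (X + m * d) + (m * X + m * (z * q))    ≡⟨ collect m X d (z * q) ⟩
  suc m * X + m * (z * q + d)            ∎
  where
  open ℕ.≤-Reasoning
  open +-*-Solver
  expand = solve 4 (λ m y X U → m :* ((y :+ X) :+ U) := m :* y :+ (m :* X :+ m :* U)) refl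
  collect = solve 4 (λ m X d Z → (X :+ m :* d) :+ (m :* X :+ m :* Z) := (con 1 :+ m) :* X :+ m :* (Z :+ d)) refl

remove-self : ∀ {k} (p : Fin k → Bool) i → remove p i i ≡ false
remove-self p i with i ≟ i
... | yes _  = refl
... | no i≢i = ⊥-elim (i≢i refl)

remove-⊆ : ∀ {k} (p : Fin k → Bool) i j → remove p i j ≡ true → p j ≡ true
remove-⊆ p i j e with i ≟ j
remove-⊆ p i j () | yes _
... | no _ = e

module Potential (q d z : ℕ) {k : ℕ} where

  Among : (Fin k → Bool) → State k → Set
  Among P s = ∀ i → P i ≡ true → present s i ≡ true

  -- Every nonempty group P of present boxes beats the threshold f(|P|),
  -- once the at most u·q elements Breaker claimed since Maker's last own
  -- move are given back.
  Safe : State k → ℕ → Set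
  Safe s u = ∀ P → Among P s → 1 ≤ count P →
             f z q d (count P) < ℕtoℚ (sumWhere P (free s) + u * q)

  weaken : ∀ {m w w'} → f z q d m < ℕtoℚ w → w ≤ w' → f z q d m < ℕtoℚ w'
  weaken F<w w≤w' = ℚ.<-≤-trans F<w (ℕtoℚ-mono-≤ w≤w')

  safe-start : (a : Fin k → ℕ) → (∀ (I : Subset k) → Nonempty I → f z q d ∣ I ∣ < ℕtoℚ (sumOver I a)) →
               Safe (st 0 (λ _ → true) a) 0
  safe-start a hyp P _ 1≤count =
    weaken {w = sumWhere P a} (subst₂ (λ n w → f z q d n < ℕtoℚ w) (∣tabulate∣ P) (sumOver-tabulate P a)
                   (hyp (tabulate P) (nonempty-tabulate P 1≤count)))
           (ℕ.m≤m+n _ 0)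

  safe-breaker : ∀ {s u} (c : Fin k → ℕ) → (∀ i → c i ≤ free s i) → Σ k c ≤ q →
                 Safe s u → Safe (st (moves s) (present s) (λ i → free s i ∸ c i)) (suc u)
  safe-breaker {s = s} {u = u} c c≤free Σc≤q safe P P⊆ 1≤count =
    weaken (safe P P⊆ 1≤count) (begin
      sumWhere P (free s) + u * q
        ≤⟨ ℕ.+-monoˡ-≤ (u * q) (sumWhere-∸ P (free s) c c≤free) ⟩
      (sumWhere P (λ i → free s i ∸ c i) + Σ k c) + u * q
        ≤⟨ ℕ.+-monoˡ-≤ (u * q) (ℕ.+-monoʳ-≤ _ Σc≤q) ⟩
      (sumWhere P (λ i → free s i ∸ c i) + q) + u * q
        ≡⟨ ℕ.+-assoc _ q (u * q) ⟩
      sumWhere P (λ i → free s i ∸ c i) + suc u * q  ∎)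
    where open ℕ.≤-Reasoning

  -- Any Maker move (in particular a stolen one) only shrinks the set of
  -- present boxes, so it keeps the invariant.
  safe-any-move : ∀ {s u} m i → Safe s u → Safe (st m (remove (present s) i) (free s)) u
  safe-any-move {s} m i safe P P⊆ = safe P (λ j Pj → remove-⊆ (present s) i j (P⊆ j Pj))

  -- Maker's own d-greedy move resets Breaker's credit: the removed box is
  -- at most d larger than any other, which pays for the u ≤ z Breaker moves.
  safe-greedy : ∀ {s u} m i → u ≤ z → present s i ≡ true → DGreedy d s i →
                Safe s u → Safe (st m (remove (present s) i) (free s)) 0
  safe-greedy {s = s} {u = u} m i u≤z present-i greedy safe P P⊆ 1≤count =
    weaken (F-descent (z * q + d) (count P) X W 1≤count F<W
                      (greedy-bound (count P) (free s i) X u q z d u≤z my≤))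
           (ℕ.m≤m+n X 0)
    where
    -- X is the size of the group P after the move, W that of P ∪ {i} before it,
    -- which is safe because box i was still present.
    X = sumWhere P (free s)
    W = (free s i + X) + u * q
    Pi≡false : P i ≡ false
    Pi≡false with P i in Pi
    ... | false = refl
    ... | true with () ← trans (sym (P⊆ i Pi)) (remove-self (present s) i)
    insert⊆ : Among (insert i P) s
    insert⊆ j Pj with only i j in ij
    ... | true  = subst (λ x → present s x ≡ true) (only-sound i j ij) present-i
    ... | false = remove-⊆ (present s) i j (P⊆ j Pj)
    count-insert : count (insert i P) ≡ suc (count P)
    count-insert = sumWhere-insert i P (λ _ → 1) Pi≡false
    F<W : f z q d (suc (count P)) < ℕtoℚ W
    F<W = subst₂ (λ n w → f z q d n < ℕtoℚ (w + u * q)) count-insert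
            (sumWhere-insert i P (free s) Pi≡false)
            (safe (insert i P) insert⊆ (subst (1 ≤_) (sym count-insert) (s≤s z≤n)))
    my≤ : count P * free s i ≤ X + count P * d
    my≤ = count-*-≤ P (free s) (free s i) d
            (λ j Pj → greedy j (remove-⊆ (present s) i j (P⊆ j Pj)))

  safe⇒nonempty : ∀ {s u} i → u ≤ z → present s i ≡ true → Safe s u → 1 ≤ free s i
  safe⇒nonempty {s} {u} i u≤z present-i safe =
    positive (ℕtoℚ-cancel-< (subst (_< _) (F-one (z * q + d)) c<free+uq))
             (ℕ.≤-trans (ℕ.*-monoˡ-≤ q u≤z) (ℕ.m≤m+n (z * q) d))
    where
    c<free+uq : f z q d 1 < ℕtoℚ (free s i + u * q)
    c<free+uq = subst₂ (λ n w → f z q d n < ℕtoℚ (w + u * q))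
                  (sumWhere-only i (λ _ → 1)) (sumWhere-only i (free s))
                  (safe (only i) (λ j ij → subst (λ x → present s x ≡ true) (only-sound i j ij) present-i)
                        (ℕ.≤-reflexive (sym (sumWhere-only i (λ _ → 1)))))
    positive : ∀ {c x y} → c ℕ.< y + x → x ≤ c → 1 ≤ y
    positive {y = suc _} _   _   = s≤s z≤n
    positive {y = zero}  c<x x≤c = ⊥-elim (ℕ.<-irrefl refl (ℕ.<-≤-trans c<x x≤c))

module Play (q d z : ℕ) (1≤z : 1 ≤ z) {k : ℕ} (a : Fin k → ℕ)
            (hyp : ∀ (I : Subset k) → Nonempty I → f z q d ∣ I ∣ < ℕtoℚ (sumOver I a)) where
  open Potential q d z

  -- u counts the Breaker moves since Maker's last own move; the move
  -- counter tracks u modulo z, so u ≤ z at Maker's turns and u < z at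
  -- Breaker's turns.
  MakerPhase : State k → ℕ → Set
  MakerPhase s u = u ≤ z × ∃ λ t → moves s ≡ u + t * z

  BreakerPhase : State k → ℕ → Set
  BreakerPhase s u = u ℕ.< z × ∃ λ t → moves s ≡ suc (u + t * z)

  mutual
    maker-turn : ∀ {s} → MakerTurn q d z a s → ∃ λ u → MakerPhase s u × Safe s u
    maker-turn start = 0 , (z≤n , 0 , refl) , safe-start a hyp
    maker-turn (breakerMove {s} b c c≤free _ Σc≤q) with breaker-turn b
    ... | u , (u<z , t , moves≡) , safe = suc u , (u<z , t , moves≡) , safe-breaker {s = s} {u = u} c c≤free Σc≤q safe

    breaker-turn : ∀ {s} → BreakerTurn q d z a s → ∃ λ u → BreakerPhase s u × Safe s u
    breaker-turn (makerMove {s} m i present-i _ greedy) with maker-turn m | z ∣? moves s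
    ... | u , (u≤z , _ , _) , safe | yes z∣moves@(divides t moves≡tz) =
      0 , (1≤z , t , cong suc moves≡tz) , safe-greedy {s = s} {u = u} (suc (moves s)) i u≤z present-i (greedy z∣moves) safe
    ... | u , (u≤z , t , moves≡) , safe | no z∤moves =
      u , (u<z , t , cong suc moves≡) , safe-any-move {s = s} {u = u} (suc (moves s)) i safe
      where
      -- if u were z, the move would be Maker's own
      u<z : u ℕ.< z
      u<z = ℕ.≤∧≢⇒< u≤z (λ u≡z → z∤moves (divides (suc t) (trans moves≡ (cong (_+ t * z) u≡z))))

lemma4 : (q d z : ℕ) → 1 ≤ z → (k : ℕ) → (a : Fin k → ℕ) →
    (∀ (I : Subset k) → Nonempty I → f z q d ∣ I ∣ < ℕtoℚ (sumOver I a)) →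
    MakerWinsGreedy q d z a
lemma4 q d z 1≤z k a hyp s turn i present-i with Play.maker-turn q d z 1≤z a hyp turn
... | _ , (u≤z , _) , safe = Potential.safe⇒nonempty q d z {s = s} i u≤z present-i safe
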